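{- Let $G$ be a connected graph of order $n$ and let $M\subseteq E(G)$ be a matching. Let $G_1,\dots,G_t$ be the connected components of $G-M$. Then $pd(G)\leq \max\{pd(G_i)\mid 1\leq i\leq t\}+1$.
   Context: All graphs are simple, finite and undirected. For an edge-coloring $c$ of a graph $G$, a set $F\subseteq E(G)$ is a proper cut if $G-F$ is disconnected and any two edges of $F$ sharing an endpoint receive different colors. A proper cut $F$ separates two vertices $x,y$ if $x$ and $y$ lie in different components of $G-F$. An edge-colored graph is proper disconnected if for every pair of distinct vertices there is a proper cut separating them. For a connected graph $G$, the proper disconnection number $pd(G)$ is the minimum $k$ such that there is an edge-coloring $c:E(G)\to\{1,\dots,k\}$ making $G$ proper disconnected (a single-vertex component has no edges and contributes $0$ to the maximum). -}

module Defs where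

open import Data.Nat using (ℕ; zero; suc; _⊔_; _≤_)
open import Data.Fin using (Fin; zero; suc)
open import Data.Product using (Σ; ∃; _×_; _,_)
open import Data.Empty using (⊥)
open import Relation.Nullary using (¬_)
open import Relation.Binary.PropositionalEquality using (_≡_; _≢_)
open import Relation.Binary.Construct.Closure.ReflexiveTransitive using (Star)

-- Vertices of every graph considered here lie in Fin n (the vertex set of
-- the host graph G). A (sub)graph is given by a vertex predicate V and an
-- edge relation E (for a simple graph: symmetric, irreflexive, edges
-- inside V).

VPred : ℕ → Set₁
VPred n = Fin n → Set

ERel : ℕ → Set₁
ERel n = Fin n → Fin n → Set

record SimpleGraph (n : ℕ) : Set₁ where
  field
    Adj     : ERel n
    sym     : ∀ {u v} → Adj u v → Adj v u
    irrefl  : ∀ {u} → ¬ Adj u u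

All : ∀ {n} → VPred n
All _ = Data.Unit.⊤
  where import Data.Unit

Reach : ∀ {n} → ERel n → Fin n → Fin n → Set
Reach E = Star E

Connected : ∀ {n} → VPred n → ERel n → Set
Connected V E = ∀ x y → V x → V y → Reach E x y

_∖_ : ∀ {n} → ERel n → ERel n → ERel n
(E ∖ F) u v = E u v × ¬ F u v

IsMatching : ∀ {n} → ERel n → ERel n → Set
IsMatching E M =
  (∀ {u v} → M u v → E u v) × (∀ {u v} → M u v → M v u) ×
  (∀ {u v w} → M u v → M u w → v ≡ w)

-- an edge-colouring of (V , E) with colours {1..k} (represented by Fin k);
-- the colour of edge uv is c u v = c v u (values off E are irrelevant)
record EdgeColoring {n} (E : ERel n) (k : ℕ) : Set where
  field
    col    : Fin n → Fin n → Fin k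
    colSym : ∀ {u v} → E u v → col u v ≡ col v u
open EdgeColoring public

record ProperCutSep {n} (E : ERel n) {k} (c : EdgeColoring E k)
                    (x y : Fin n) : Set₁ where
  field
    F        : ERel n
    F⊆E      : ∀ {u v} → F u v → E u v
    Fsym     : ∀ {u v} → F u v → F v u
    proper   : ∀ {u v w} → F u v → F u w → v ≢ w → col c u v ≢ col c u w
    separates : ¬ Reach (E ∖ F) x y

ProperDisconnected : ∀ {n} → VPred n → (E : ERel n) → ∀ {k} →
                     EdgeColoring E k → Set₁
ProperDisconnected V E c =
  ∀ x y → V x → V y → x ≢ y → ProperCutSep E c x y

PdColorable : ∀ {n} → VPred n → ERel n → ℕ → Set₁
PdColorable V E k = Σ (EdgeColoring E k) (λ c → ProperDisconnected V E c)

IsPd : ∀ {n} → VPred n → ERel n → ℕ → Set₁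
IsPd V E p = PdColorable V E p × (∀ q → PdColorable V E q → p ≤ q)

-- the connected component of G - M containing r, as a graph (C , E_C)
CompV : ∀ {n} → ERel n → Fin n → VPred n
CompV E' r v = Reach E' r v

CompE : ∀ {n} → ERel n → Fin n → ERel n
CompE E' r u v = Reach E' r u × E' u v

maxF : ∀ m → (Fin m → ℕ) → ℕ
maxF zero    f = 0
maxF (suc m) f = f zero ⊔ maxF m (λ i → f (suc i))

{-# OPTIONS --safe #-}
module Submission where

-- Colour the edges of the matching M with one fresh colour and every component
-- of G − M with its own proper-disconnecting colouring, all drawn from one
-- common palette of max pd(Gᵢ) colours. Two vertices in different components
-- are separated by M itself, a proper cut because no two edges of a matching
-- meet. Two vertices in the same component are separated by the component's
-- proper cut together with M, which stays proper since the fresh colour occurs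
-- nowhere else.
--
-- Building this colouring needs decisions (is uv ∈ M? is v reachable from u in
-- G − M?) and a canonical root per component. Since the conclusion q ≤ … is
-- decidable, these instances of excluded middle may be assumed under a double
-- negation.

open import Defs
open import Data.Nat using (ℕ; zero; suc; _≤_; _≤?_)
open import Data.Nat.Properties using (m≤m⊔n; m≤n⊔m; ≤-trans)
open import Data.Fin using (Fin; Fin′; zero; suc; inject; inject₁; inject≤; fromℕ; fromℕ<; _<_)
open import Data.Fin.Properties
  using (∀-cons; ¬∀⟶∃¬-smallest; <-cmp; toℕ-injective; toℕ-inject; toℕ-fromℕ<;
         fromℕ≢inject₁; inject₁-injective; inject≤-injective)
open import Data.Product using (Σ; _×_; _,_; proj₁; proj₂)
open import Data.Sum using (_⊎_; inj₁; inj₂; [_,_]) renaming (map to ⊎-map)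
open import Function using (_∘_)
open import Relation.Binary.Core using (Rel)
open import Relation.Binary.Definitions using (Decidable; Symmetric; tri<; tri≈; tri>)
open import Relation.Binary.Structures using (IsEquivalence)
open import Relation.Binary.PropositionalEquality
  using (_≡_; _≢_; refl; sym; trans; cong; subst; module ≡-Reasoning)
open import Relation.Binary.Construct.Closure.ReflexiveTransitive
  using (Star; ε; _◅_; _◅◅_; reverse)
open import Relation.Nullary using (¬_; Dec; yes; no; ¬?)
open import Relation.Nullary.Decidable using (decidable-stable; ¬¬-excluded-middle)
open import Relation.Nullary.Negation using (contradiction)
open import Relation.Unary using (Pred)

¬¬-∀-Fin : ∀ n {p} {P : Pred (Fin n) p} → (∀ i → ¬ ¬ P i) → ¬ ¬ (∀ i → P i)
¬¬-∀-Fin zero    ¬¬P ¬∀P = ¬∀P (λ ())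
¬¬-∀-Fin (suc n) ¬¬P ¬∀P = ¬¬P zero λ P₀ → ¬¬-∀-Fin n (¬¬P ∘ suc) (¬∀P ∘ ∀-cons P₀)

¬¬-decidable : ∀ {n ℓ} (R : Rel (Fin n) ℓ) → ¬ ¬ Decidable R
¬¬-decidable {n} R = ¬¬-∀-Fin n λ u → ¬¬-∀-Fin n λ v → ¬¬-excluded-middle

Least : ∀ {n p} → Pred (Fin n) p → Pred (Fin n) p
Least P i = P i × (∀ (j : Fin′ i) → ¬ P (inject j))

inject-fromℕ< : ∀ {n} {i j : Fin n} (i<j : i < j) → inject {i = j} (fromℕ< i<j) ≡ i
inject-fromℕ< i<j = toℕ-injective (trans (toℕ-inject _) (toℕ-fromℕ< i<j))

least-minimal : ∀ {n p} {P : Pred (Fin n) p} {i j} → Least P j → i < j → ¬ P i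
least-minimal {P = P} (_ , below) i<j Pi = below (fromℕ< i<j) (subst P (sym (inject-fromℕ< i<j)) Pi)

least-unique : ∀ {n p} {P : Pred (Fin n) p} {i j} → Least P i → Least P j → i ≡ j
least-unique {i = i} {j} Li Lj with <-cmp i j
... | tri< i<j _ _ = contradiction (proj₁ Li) (least-minimal Lj i<j)
... | tri≈ _ i≡j _ = i≡j
... | tri> _ _ j<i = contradiction (proj₁ Lj) (least-minimal Li j<i)

least-resp : ∀ {n p q} {P : Pred (Fin n) p} {Q : Pred (Fin n) q} {i} →
             (∀ {j} → P j → Q j) → (∀ {j} → Q j → P j) → Least P i → Least Q i
least-resp P⇒Q Q⇒P (Pi , below) = P⇒Q Pi , λ j → below j ∘ Q⇒P

record Representatives {n ℓ} (_~_ : Rel (Fin n) ℓ) : Set ℓ where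
  field
    rep      : Fin n → Fin n
    rep-~    : ∀ v → rep v ~ v
    rep-cong : ∀ {u v} → u ~ v → rep u ≡ rep v

module _ {n ℓ} {_~_ : Rel (Fin n) ℓ} (isEquivalence : IsEquivalence _~_) (_~?_ : Decidable _~_) where
  open IsEquivalence isEquivalence renaming (refl to ~-refl; sym to ~-sym; trans to ~-trans)

  leastInClass : ∀ v → Σ (Fin n) (Least (_~ v))
  leastInClass v with ¬∀⟶∃¬-smallest n (λ r → ¬ r ~ v) (λ r → ¬? (r ~? v)) (λ ≁v → ≁v v ~-refl)
  ... | r , ¬≁ , below = r , decidable-stable (r ~? v) ¬≁ , below

  leastInClass-cong : ∀ {u v} → u ~ v → proj₁ (leastInClass u) ≡ proj₁ (leastInClass v)
  leastInClass-cong {u} {v} u~v = least-unique {P = _~ v}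
    (least-resp {P = _~ u} (λ r~u → ~-trans r~u u~v) (λ r~v → ~-trans r~v (~-sym u~v))
                (proj₂ (leastInClass u)))
    (proj₂ (leastInClass v))

  representatives : Representatives _~_
  representatives = record
    { rep      = proj₁ ∘ leastInClass
    ; rep-~    = proj₁ ∘ proj₂ ∘ leastInClass
    ; rep-cong = leastInClass-cong
    }

≤-maxF : ∀ n (p : Fin n → ℕ) i → p i ≤ maxF n p
≤-maxF (suc n) p zero    = m≤m⊔n (p zero) _
≤-maxF (suc n) p (suc i) = ≤-trans (≤-maxF n (p ∘ suc) i) (m≤n⊔m (p zero) _)

pdColorable-mono : ∀ {n} {V : VPred n} {E : ERel n} {k l} → k ≤ l →
                   PdColorable V E k → PdColorable V E l
pdColorable-mono {E = E} {l = l} k≤l (c , pd) = c′ , λ x y Vx Vy x≢y → widen (pd x y Vx Vy x≢y)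
  where
  c′ : EdgeColoring E l
  c′ = record
    { col    = λ u v → inject≤ (col c u v) k≤l
    ; colSym = cong (λ i → inject≤ i k≤l) ∘ colSym c
    }
  widen : ∀ {x y} → ProperCutSep E c x y → ProperCutSep E c′ x y
  widen cut = record
    { F         = F
    ; F⊆E       = F⊆E
    ; Fsym      = Fsym
    ; proper    = λ uv uw v≢w → proper uv uw v≢w ∘ inject≤-injective _ _ _ _
    ; separates = separates
    }
    where open ProperCutSep cut

module _ {n} (G : SimpleGraph n) (M : ERel n) (matching : IsMatching (SimpleGraph.Adj G) M)
         (M? : Decidable M) (reach? : Decidable (Reach (SimpleGraph.Adj G ∖ M))) {k}
         (componentPd : ∀ r → PdColorable (CompV (SimpleGraph.Adj G ∖ M) r)
                                          (CompE (SimpleGraph.Adj G ∖ M) r) k) where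
  open SimpleGraph G using (Adj) renaming (sym to Adj-sym)

  Adj∖M : ERel n
  Adj∖M = Adj ∖ M

  M⊆Adj : ∀ {u v} → M u v → Adj u v
  M⊆Adj = proj₁ matching

  M-sym : Symmetric M
  M-sym = proj₁ (proj₂ matching)

  M-unique : ∀ {u v w} → M u v → M u w → v ≡ w
  M-unique = proj₂ (proj₂ matching)

  Adj∖M-sym : Symmetric Adj∖M
  Adj∖M-sym (uv , ¬Muv) = Adj-sym uv , ¬Muv ∘ M-sym

  reach-isEquivalence : IsEquivalence (Reach Adj∖M)
  reach-isEquivalence = record { refl = ε ; sym = reverse Adj∖M-sym ; trans = _◅◅_ }

  open Representatives (representatives reach-isEquivalence reach?)
    renaming (rep to root; rep-~ to root-reach; rep-cong to root-cong)

  sameRoot : ∀ {x u} → Reach Adj∖M (root x) u → root u ≡ root x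
  sameRoot {x} xu = root-cong (reverse Adj∖M-sym xu ◅◅ root-reach x)

  componentColoring : ∀ r → EdgeColoring (CompE Adj∖M r) k
  componentColoring r = proj₁ (componentPd r)

  color : Fin n → Fin n → Fin (suc k)
  color u v with M? u v
  ... | yes _ = fromℕ k
  ... | no  _ = inject₁ (col (componentColoring (root u)) u v)

  color-M : ∀ {u v} → M u v → color u v ≡ fromℕ k
  color-M {u} {v} Muv with M? u v
  ... | yes _   = refl
  ... | no ¬Muv = contradiction Muv ¬Muv

  color-∉M : ∀ {u v r} → ¬ M u v → root u ≡ r → color u v ≡ inject₁ (col (componentColoring r) u v)
  color-∉M {u} {v} ¬Muv refl with M? u v
  ... | yes Muv = contradiction Muv ¬Muv
  ... | no  _   = refl

  color-fresh : ∀ {u v w} → M u v → ¬ M u w → color u v ≢ color u w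
  color-fresh Muv ¬Muw eq =
    fromℕ≢inject₁ (trans (sym (color-M Muv)) (trans eq (color-∉M ¬Muw refl)))

  color-sym : ∀ {u v} → Adj u v → color u v ≡ color v u
  color-sym {u} {v} uv = byMembership (M? u v)
    where
    open ≡-Reasoning
    r = root u
    byMembership : Dec (M u v) → color u v ≡ color v u
    byMembership (yes Muv) = trans (color-M Muv) (sym (color-M (M-sym Muv)))
    byMembership (no ¬Muv) = begin
      color u v                               ≡⟨ color-∉M ¬Muv refl ⟩
      inject₁ (col (componentColoring r) u v) ≡⟨ cong inject₁ (colSym (componentColoring r) (root-reach u , e)) ⟩
      inject₁ (col (componentColoring r) v u) ≡⟨ color-∉M (¬Muv ∘ M-sym) (sameRoot (root-reach u ◅◅ e ◅ ε)) ⟨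
      color v u                               ∎
      where e = uv , ¬Muv

  coloring : EdgeColoring Adj (suc k)
  coloring = record { col = color ; colSym = color-sym }

  matchingCut : ∀ {x y} → ¬ Reach Adj∖M x y → ProperCutSep Adj coloring x y
  matchingCut ¬xy = record
    { F         = M
    ; F⊆E       = M⊆Adj
    ; Fsym      = M-sym
    ; proper    = λ Muv Muw v≢w → contradiction (M-unique Muv Muw) v≢w
    ; separates = ¬xy
    }

  extendCut : ∀ {x y} → ProperCutSep (CompE Adj∖M (root x)) (componentColoring (root x)) x y →
              ProperCutSep Adj coloring x y
  extendCut {x} cut = record
    { F         = F
    ; F⊆E       = [ proj₁ ∘ proj₂ ∘ Fᵣ⊆E , M⊆Adj ]
    ; Fsym      = ⊎-map Fᵣ-sym M-sym
    ; proper    = proper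
    ; separates = separatesᵣ ∘ lift (root-reach x)
    }
    where
    open ProperCutSep cut renaming
      (F to Fᵣ; F⊆E to Fᵣ⊆E; Fsym to Fᵣ-sym; proper to properᵣ; separates to separatesᵣ)
    r = root x

    F : ERel n
    F u v = Fᵣ u v ⊎ M u v

    Fᵣ-∉M : ∀ {u v} → Fᵣ u v → ¬ M u v
    Fᵣ-∉M = proj₂ ∘ proj₂ ∘ Fᵣ⊆E

    Fᵣ-color : ∀ {u v} → Fᵣ u v → color u v ≡ inject₁ (col (componentColoring r) u v)
    Fᵣ-color f = color-∉M (Fᵣ-∉M f) (sameRoot (proj₁ (Fᵣ⊆E f)))

    proper : ∀ {u v w} → F u v → F u w → v ≢ w → color u v ≢ color u w
    proper (inj₁ f) (inj₁ g) v≢w eq =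
      properᵣ f g v≢w (inject₁-injective (trans (sym (Fᵣ-color f)) (trans eq (Fᵣ-color g))))
    proper (inj₁ f) (inj₂ m) _ = color-fresh m (Fᵣ-∉M f) ∘ sym
    proper (inj₂ m) (inj₁ g) _ = color-fresh m (Fᵣ-∉M g)
    proper (inj₂ m) (inj₂ m′) v≢w = contradiction (M-unique m m′) v≢w

    lift : ∀ {a b} → Reach Adj∖M r a → Star (Adj ∖ F) a b → Star (CompE Adj∖M r ∖ Fᵣ) a b
    lift ra ε                 = ε
    lift ra ((ab , ¬F) ◅ ab*) = ((ra , e) , ¬F ∘ inj₁) ◅ lift (ra ◅◅ e ◅ ε) ab*
      where e = ab , ¬F ∘ inj₂

  pdColorable-from-components : PdColorable All Adj (suc k)
  pdColorable-from-components = coloring , λ x y _ _ x≢y → cutFor x≢y (reach? x y)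
    where
    cutFor : ∀ {x y} → x ≢ y → Dec (Reach Adj∖M x y) → ProperCutSep Adj coloring x y
    cutFor {x} {y} x≢y (yes xy) =
      extendCut (proj₂ (componentPd (root x)) x y (root-reach x) (root-reach x ◅◅ xy) x≢y)
    cutFor x≢y (no ¬xy) = matchingCut ¬xy

lemma3p12 : (n : ℕ) (G : SimpleGraph n) → Connected All (SimpleGraph.Adj G) →
    (M : ERel n) → IsMatching (SimpleGraph.Adj G) M →
    (p : Fin n → ℕ) →
    (∀ r → IsPd (CompV (SimpleGraph.Adj G ∖ M) r) (CompE (SimpleGraph.Adj G ∖ M) r) (p r)) →
    (q : ℕ) → IsPd All (SimpleGraph.Adj G) q →
    q ≤ suc (maxF n p)
lemma3p12 n G _ M matching p componentsPd q (_ , q-minimal) =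
  decidable-stable (q ≤? suc (maxF n p)) λ q≰ →
    ¬¬-decidable M λ M? →
    ¬¬-decidable (Reach (SimpleGraph.Adj G ∖ M)) λ reach? →
    q≰ (q-minimal _ (pdColorable-from-components G M matching M? reach? λ r →
      pdColorable-mono (≤-maxF n p r) (proj₁ (componentsPd r))))
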